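{- Let $a\le b\le c$ be positive integers. For every integer $m\ge0$, $a^{2m+1}+b^{2m+1}-c^{2m+1}=0$ if and only if \[ \sum_{j=0}^{a-1}P^{\rm Inv}_m(j(j+1))=\sum_{j=b}^{c-1}P^{\rm Inv}_m(j(j+1)); \] hence Fermat's Last Theorem for odd exponents is equivalent to this equation having no such solutions for any $m\ge1$. Similarly, for every integer $m\ge1$, $a^{2m}+b^{2m}-c^{2m}=0$ if and only if \[ \sum_{j=0}^{a-1}(2j+1)\mathcal{Q}^{\rm Inv}_m(j(j+1))=\sum_{j=b}^{c-1}(2j+1)\mathcal{Q}^{\rm Inv}_m(j(j+1)), \] so Fermat's Last Theorem for even exponents is equivalent to this equation having no such solutions for any $m\ge2$.
   Context: For integers $m,k\ge0$: $T_k(m)=\binom{m+k+1}{2k+1}+\binom{m+k}{2k+1}$; $P^{\rm Inv}_m(x)=\sum_{k=0}^mT_k(m)x^{m-k}$; for $m\ge1$, $\mathcal{Q}^{\rm Inv}_m(x)=\sum_{k=1}^m\binom{m+k-1}{2k-1}x^{m-k}$. -}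

module Defs where

open import Data.Nat using (ℕ; zero; suc; _+_; _*_; _∸_; _^_)
open import Data.Nat.Combinatorics using (_C_)

T : ℕ → ℕ → ℕ
T k m = ((m + k + 1) C (2 * k + 1)) + ((m + k) C (2 * k + 1))

sumTo : ℕ → (ℕ → ℕ) → ℕ
sumTo zero    f = f 0
sumTo (suc n) f = sumTo n f + f (suc n)

sumRange : ℕ → ℕ → (ℕ → ℕ) → ℕ
sumRange lo hi f = go (hi ∸ lo)
  where
  go : ℕ → ℕ
  go zero    = 0
  go (suc n) = go n + f (lo + n)

PInv : ℕ → ℕ → ℕ
PInv m x = sumTo m (λ k → T k m * x ^ (m ∸ k))

QInv : ℕ → ℕ → ℕ
QInv m x = sumRange 1 (suc m) (λ k → ((m + k ∸ 1) C (2 * k ∸ 1)) * x ^ (m ∸ k))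

{-# OPTIONS --safe #-}
-- The Fibonacci polynomials F_N(x) = Σ_i C(N−i, i) x^i satisfy F_{N+2} = F_{N+1} + x F_N. At
-- x = n(n+1) the characteristic roots are n+1 and −n, so (2n+1) F_N = (n+1)^{N+1} − (−n)^{N+1}.
-- Reindexing the binomial sums gives Q^Inv_m = F_{2m−1} and P^Inv_m = F_{2m+1} + x F_{2m−1}, hence
-- P^Inv_m(n(n+1)) = (n+1)^{2m+1} − n^{2m+1} and (2n+1) Q^Inv_m(n(n+1)) = (n+1)^{2m} − n^{2m}.
-- Both sides of each equation therefore telescope: the left one to a^k, the right one to c^k − b^k.
module Submission where

open import Defs
open import Data.Nat using (ℕ; zero; suc; _+_; _*_; _∸_; _^_; _≤_; _<_; z≤n; s≤s; _≤?_)
open import Data.Nat.Properties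
open import Data.Nat.Combinatorics using (_C_; k>n⇒nCk≡0; nCk≡nC[n∸k]; nCk+nC[k+1]≡[n+1]C[k+1])
open import Data.Nat.Tactic.RingSolver using (solve-∀)
open import Algebra.Properties.CommutativeSemigroup +-commutativeSemigroup
  using () renaming (interchange to +-interchange)
open import Data.Product using (_×_; _,_; proj₁; proj₂; Σ-syntax)
open import Function.Bundles using (_⇔_; mk⇔; Equivalence)
open import Relation.Binary.PropositionalEquality
  using (_≡_; refl; sym; trans; cong; cong₂; module ≡-Reasoning)
open import Relation.Nullary using (¬_; yes; no)

open ≡-Reasoning

sumTo-cong : ∀ n {f g : ℕ → ℕ} → (∀ i → i ≤ n → f i ≡ g i) → sumTo n f ≡ sumTo n g
sumTo-cong zero    f≗g = f≗g 0 z≤n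
sumTo-cong (suc n) f≗g =
  cong₂ _+_ (sumTo-cong n (λ i i≤n → f≗g i (m≤n⇒m≤1+n i≤n))) (f≗g (suc n) ≤-refl)

sumTo-zero : ∀ n (f : ℕ → ℕ) → (∀ i → f i ≡ 0) → sumTo n f ≡ 0
sumTo-zero zero    f f≗0 = f≗0 0
sumTo-zero (suc n) f f≗0 = cong₂ _+_ (sumTo-zero n f f≗0) (f≗0 (suc n))

sumTo-+ : ∀ n (f g : ℕ → ℕ) → sumTo n (λ i → f i + g i) ≡ sumTo n f + sumTo n g
sumTo-+ zero    f g = refl
sumTo-+ (suc n) f g =
  trans (cong (_+ (f (suc n) + g (suc n))) (sumTo-+ n f g))
        (+-interchange (sumTo n f) (sumTo n g) (f (suc n)) (g (suc n)))

sumTo-*ˡ : ∀ n c (f : ℕ → ℕ) → sumTo n (λ i → c * f i) ≡ c * sumTo n f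
sumTo-*ˡ zero    c f = refl
sumTo-*ˡ (suc n) c f =
  trans (cong (_+ c * f (suc n)) (sumTo-*ˡ n c f)) (sym (*-distribˡ-+ c _ _))

sumTo-sucˡ : ∀ n f → sumTo (suc n) f ≡ f 0 + sumTo n (λ i → f (suc i))
sumTo-sucˡ zero    f = refl
sumTo-sucˡ (suc n) f =
  trans (cong (_+ f (suc (suc n))) (sumTo-sucˡ n f)) (+-assoc (f 0) _ _)

sumTo-++ : ∀ m n f → sumTo (m + suc n) f ≡ sumTo m f + sumTo n (λ j → f (suc m + j))
sumTo-++ m zero    f rewrite +-suc m 0 | +-identityʳ m = refl
sumTo-++ m (suc n) f rewrite +-suc m (suc n) =
  trans (cong (_+ f (suc (m + suc n))) (sumTo-++ m n f)) (+-assoc (sumTo m f) _ _)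

sumTo-reverse : ∀ n f → sumTo n f ≡ sumTo n (λ i → f (n ∸ i))
sumTo-reverse zero    f = refl
sumTo-reverse (suc n) f = begin
  sumTo n f + f (suc n)                  ≡⟨ cong (_+ f (suc n)) (sumTo-reverse n f) ⟩
  sumTo n (λ i → f (n ∸ i)) + f (suc n)  ≡⟨ +-comm _ (f (suc n)) ⟩
  f (suc n) + sumTo n (λ i → f (n ∸ i))  ≡⟨ sym (sumTo-sucˡ n (λ i → f (suc n ∸ i))) ⟩
  sumTo (suc n) (λ i → f (suc n ∸ i))    ∎

sumRange-sucʳ : ∀ lo hi f → lo ≤ hi → sumRange lo (suc hi) f ≡ sumRange lo hi f + f hi
sumRange-sucʳ lo hi f lo≤hi with suc hi ∸ lo | +-∸-assoc 1 lo≤hi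
... | _ | refl = cong (sumRange lo hi f +_) (cong f (m+[n∸m]≡n lo≤hi))

sumRange-empty : ∀ b f → sumRange b b f ≡ 0
sumRange-empty b f with b ∸ b | n∸n≡0 b
... | _ | refl = refl

sumRange-split : ∀ b c f → b ≤ c → sumRange 0 c f ≡ sumRange 0 b f + sumRange b c f
sumRange-split .zero zero f z≤n = refl
sumRange-split b (suc c) f b≤1+c with b ≤? c
... | yes b≤c = begin
  sumRange 0 c f + f c                     ≡⟨ cong (_+ f c) (sumRange-split b c f b≤c) ⟩
  sumRange 0 b f + sumRange b c f + f c    ≡⟨ +-assoc (sumRange 0 b f) _ _ ⟩
  sumRange 0 b f + (sumRange b c f + f c)  ≡⟨ cong (sumRange 0 b f +_) (sym (sumRange-sucʳ b c f b≤c)) ⟩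
  sumRange 0 b f + sumRange b (suc c) f    ∎
... | no b≰c with ≤-antisym b≤1+c (≰⇒> b≰c)
... | refl = begin
  sumRange 0 (suc c) f                               ≡⟨ sym (+-identityʳ _) ⟩
  sumRange 0 (suc c) f + 0                           ≡⟨ cong (sumRange 0 (suc c) f +_) (sym (sumRange-empty (suc c) f)) ⟩
  sumRange 0 (suc c) f + sumRange (suc c) (suc c) f  ∎

sumRange-from-1 : ∀ m f → sumRange 1 (suc (suc m)) f ≡ sumTo m (λ i → f (suc i))
sumRange-from-1 zero    f = refl
sumRange-from-1 (suc m) f = cong (_+ f (suc (suc m))) (sumRange-from-1 m f)

fibTerm : ℕ → ℕ → ℕ → ℕ
fibTerm x N i = ((N ∸ i) C i) * x ^ i

fibPoly : ℕ → ℕ → ℕ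
fibPoly x N = sumTo N (fibTerm x N)

diagonal-C-vanish : ∀ {N k} → N < k → (N ∸ k) C k ≡ 0
diagonal-C-vanish {N} {k} N<k rewrite m≤n⇒m∸n≡0 (<⇒≤ N<k) = k>n⇒nCk≡0 (≤-trans (s≤s z≤n) N<k)

diagonal-pascal : ∀ N j → (suc N ∸ j) C suc j ≡ (N ∸ j) C j + (N ∸ j) C suc j
diagonal-pascal N j with j ≤? N
... | yes j≤N rewrite +-∸-assoc 1 j≤N = sym (nCk+nC[k+1]≡[n+1]C[k+1] (N ∸ j) j)
... | no j≰N rewrite m≤n⇒m∸n≡0 (≰⇒> j≰N) | m≤n⇒m∸n≡0 (<⇒≤ (≰⇒> j≰N)) =
  sym (trans (+-identityʳ (0 C j)) (k>n⇒nCk≡0 (≤-trans (s≤s z≤n) (≰⇒> j≰N))))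

fibPoly-pad : ∀ x N → fibPoly x N ≡ sumTo (suc N) (fibTerm x N)
fibPoly-pad x N =
  sym (trans (cong (fibPoly x N +_) (cong (_* x ^ suc N) (diagonal-C-vanish {N} ≤-refl))) (+-identityʳ _))

fibPoly-rec : ∀ x N → fibPoly x (suc (suc N)) ≡ fibPoly x (suc N) + x * fibPoly x N
fibPoly-rec x N = begin
  fibPoly x (suc (suc N))
    ≡⟨ sumTo-sucˡ (suc N) (fibTerm x (suc (suc N))) ⟩
  1 + sumTo (suc N) (λ j → fibTerm x (suc (suc N)) (suc j))
    ≡⟨ cong (1 +_) (sumTo-cong (suc N) (λ j _ → pascal-term j)) ⟩
  1 + sumTo (suc N) (λ j → x * fibTerm x N j + shifted j)
    ≡⟨ cong (1 +_) (sumTo-+ (suc N) _ shifted) ⟩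
  1 + (sumTo (suc N) (λ j → x * fibTerm x N j) + sumTo (suc N) shifted)
    ≡⟨ cong (λ s → 1 + (s + sumTo (suc N) shifted)) (sumTo-*ˡ (suc N) x (fibTerm x N)) ⟩
  1 + (x * sumTo (suc N) (fibTerm x N) + sumTo (suc N) shifted)
    ≡⟨ reorder (x * sumTo (suc N) (fibTerm x N)) (sumTo (suc N) shifted) ⟩
  (1 + sumTo (suc N) shifted) + x * sumTo (suc N) (fibTerm x N)
    ≡⟨ cong₂ (λ s t → s + x * t) (sym (sumTo-sucˡ (suc N) (fibTerm x (suc N)))) (sym (fibPoly-pad x N)) ⟩
  sumTo (suc (suc N)) (fibTerm x (suc N)) + x * fibPoly x N
    ≡⟨ cong (_+ x * fibPoly x N) (sym (fibPoly-pad x (suc N))) ⟩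
  fibPoly x (suc N) + x * fibPoly x N
    ∎
  where
  shifted : ℕ → ℕ
  shifted j = fibTerm x (suc N) (suc j)
  pascal-term : ∀ j → fibTerm x (suc (suc N)) (suc j) ≡ x * fibTerm x N j + shifted j
  pascal-term j = trans (cong (_* (x * x ^ j)) (diagonal-pascal N j)) (distrib ((N ∸ j) C j) ((N ∸ j) C suc j) x (x ^ j))
    where
    distrib : ∀ a b x y → (a + b) * (x * y) ≡ x * (a * y) + b * (x * y)
    distrib = solve-∀
  reorder : ∀ a b → 1 + (a + b) ≡ (1 + b) + a
  reorder = solve-∀

double : ℕ → ℕ
double zero    = zero
double (suc m) = suc (suc (double m))

double≡m+m : ∀ m → double m ≡ m + m
double≡m+m zero    = refl
double≡m+m (suc m) = cong suc (trans (cong suc (double≡m+m m)) (sym (+-suc m m)))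

-- The closed form (2n+1) F_N = (n+1)^{N+1} − (−n)^{N+1}, split by the parity of N to avoid subtraction.
module _ (n : ℕ) where
  private
    u = suc n
    x = n * suc n
    w = suc (n + n)

  fibPoly-closedForm : ∀ m →
      (w * fibPoly x (double m) ≡ u ^ suc (double m) + n ^ suc (double m))
    × (w * fibPoly x (suc (double m)) + n ^ suc (suc (double m)) ≡ u ^ suc (suc (double m)))
  fibPoly-closedForm zero = base-even n , base-odd n
    where
    base-even : ∀ n → suc (n + n) * 1 ≡ suc n * 1 + n * 1
    base-even = solve-∀
    base-odd : ∀ n → suc (n + n) * 1 + n * (n * 1) ≡ suc n * (suc n * 1)
    base-odd = solve-∀
  fibPoly-closedForm (suc m) = even , odd
    where
    d = double m
    p = u ^ suc d
    q = n ^ suc d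
    even : w * fibPoly x (suc (suc d)) ≡ u * (u * p) + n * (n * q)
    even = +-cancelʳ-≡ (n * q) _ _ (begin
      w * fibPoly x (suc (suc d)) + n * q
        ≡⟨ cong (λ F → w * F + n * q) (fibPoly-rec x d) ⟩
      w * (fibPoly x (suc d) + x * fibPoly x d) + n * q
        ≡⟨ regroup n w _ _ q ⟩
      (w * fibPoly x (suc d) + n * q) + x * (w * fibPoly x d)
        ≡⟨ cong₂ (λ s t → s + x * t) (proj₂ (fibPoly-closedForm m)) (proj₁ (fibPoly-closedForm m)) ⟩
      u * p + x * (p + q)
        ≡⟨ expand n p q ⟩
      (u * (u * p) + n * (n * q)) + n * q ∎)
      where
      regroup : ∀ n w a b q → w * (a + (n * suc n) * b) + n * q ≡ (w * a + n * q) + (n * suc n) * (w * b)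
      regroup = solve-∀
      expand : ∀ n p q → suc n * p + (n * suc n) * (p + q) ≡ (suc n * (suc n * p) + n * (n * q)) + n * q
      expand = solve-∀
    odd : w * fibPoly x (suc (suc (suc d))) + n * (n * (n * q)) ≡ u * (u * (u * p))
    odd = +-cancelʳ-≡ (x * (n * q)) _ _ (begin
      w * fibPoly x (suc (suc (suc d))) + n * (n * (n * q)) + x * (n * q)
        ≡⟨ cong (λ F → w * F + n * (n * (n * q)) + x * (n * q)) (fibPoly-rec x (suc d)) ⟩
      w * (fibPoly x (suc (suc d)) + x * fibPoly x (suc d)) + n * (n * (n * q)) + x * (n * q)
        ≡⟨ regroup n w _ _ q ⟩
      w * fibPoly x (suc (suc d)) + x * (w * fibPoly x (suc d) + n * q) + n * (n * (n * q))
        ≡⟨ cong₂ (λ s t → s + x * t + n * (n * (n * q))) even (proj₂ (fibPoly-closedForm m)) ⟩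
      u * (u * p) + n * (n * q) + x * (u * p) + n * (n * (n * q))
        ≡⟨ expand n p q ⟩
      u * (u * (u * p)) + x * (n * q) ∎)
      where
      regroup : ∀ n w c a q → w * (c + (n * suc n) * a) + n * (n * (n * q)) + (n * suc n) * (n * q)
                              ≡ w * c + (n * suc n) * (w * a + n * q) + n * (n * (n * q))
      regroup = solve-∀
      expand : ∀ n p q → suc n * (suc n * p) + n * (n * q) + (n * suc n) * (suc n * p) + n * (n * (n * q))
                         ≡ suc n * (suc n * (suc n * p)) + (n * suc n) * (n * q)
      expand = solve-∀

PInv-upper : ℕ → ℕ → ℕ
PInv-upper m x = sumTo m (λ k → ((m + k + 1) C (2 * k + 1)) * x ^ (m ∸ k))

PInv-lower : ℕ → ℕ → ℕ
PInv-lower m x = sumTo m (λ k → ((m + k) C (2 * k + 1)) * x ^ (m ∸ k))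

PInv≡upper+lower : ∀ m x → PInv m x ≡ PInv-upper m x + PInv-lower m x
PInv≡upper+lower m x =
  trans (sumTo-cong m (λ k _ → *-distribʳ-+ (x ^ (m ∸ k)) ((m + k + 1) C (2 * k + 1)) _))
        (sumTo-+ m _ _)

PInv-lower-suc : ∀ m x → PInv-lower (suc m) x ≡ x * PInv-upper m x
PInv-lower-suc m x = begin
  sumTo m lower + lower (suc m)       ≡⟨ cong₂ _+_ (sumTo-cong m lower≡x*upper) top-vanishes ⟩
  sumTo m (λ k → x * upper k) + 0     ≡⟨ +-identityʳ _ ⟩
  sumTo m (λ k → x * upper k)         ≡⟨ sumTo-*ˡ m x upper ⟩
  x * PInv-upper m x                  ∎
  where
  lower upper : ℕ → ℕ
  lower k = ((suc m + k) C (2 * k + 1)) * x ^ (suc m ∸ k)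
  upper k = ((m + k + 1) C (2 * k + 1)) * x ^ (m ∸ k)
  suc-m+k : ∀ m k → suc m + k ≡ m + k + 1
  suc-m+k = solve-∀
  lower≡x*upper : ∀ k → k ≤ m → lower k ≡ x * upper k
  lower≡x*upper k k≤m rewrite suc-m+k m k | +-∸-assoc 1 k≤m = x*-commute ((m + k + 1) C (2 * k + 1)) (x ^ (m ∸ k))
    where
    x*-commute : ∀ a c → a * (x * c) ≡ x * (a * c)
    x*-commute a c = trans (sym (*-assoc a x c)) (trans (cong (_* c) (*-comm a x)) (*-assoc x a c))
  top-vanishes : lower (suc m) ≡ 0
  top-vanishes = cong (_* x ^ (m ∸ m)) (k>n⇒nCk≡0 (m+m<2m+1 (suc m)))
    where
    m+m<2m+1 : ∀ k → k + k < 2 * k + 1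
    m+m<2m+1 k = ≤-reflexive (sym (2k+1 k))
      where
      2k+1 : ∀ k → 2 * k + 1 ≡ suc (k + k)
      2k+1 = solve-∀

QInv-suc≡PInv-upper : ∀ m x → QInv (suc m) x ≡ PInv-upper m x
QInv-suc≡PInv-upper m x =
  trans (sumRange-from-1 m _)
        (sumTo-cong m (λ k _ → cong₂ (λ a b → (a C b) * x ^ (m ∸ k)) (top m k) (bottom k)))
  where
  top : ∀ m k → m + suc k ≡ m + k + 1
  top = solve-∀
  bottom : ∀ k → k + suc (k + 0) ≡ 2 * k + 1
  bottom = solve-∀

C-reindex : ∀ i r → (suc (double (i + r)) ∸ i) C i ≡ (i + r + r + 1) C (2 * r + 1)
C-reindex i r = begin
  (suc (double (i + r)) ∸ i) C i     ≡⟨ cong (λ t → (t ∸ i) C i) (unfold-double i r) ⟩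
  (i + (i + (2 * r + 1)) ∸ i) C i    ≡⟨ cong (_C i) (m+n∸m≡n i _) ⟩
  (i + (2 * r + 1)) C i              ≡⟨ nCk≡nC[n∸k] (m≤m+n i _) ⟩
  (i + (2 * r + 1)) C (i + (2 * r + 1) ∸ i)
                                     ≡⟨ cong ((i + (2 * r + 1)) C_) (m+n∸m≡n i _) ⟩
  (i + (2 * r + 1)) C (2 * r + 1)    ≡⟨ cong (_C (2 * r + 1)) (regroup i r) ⟩
  (i + r + r + 1) C (2 * r + 1)      ∎
  where
  unfold-double : ∀ i r → suc (double (i + r)) ≡ i + (i + (2 * r + 1))
  unfold-double i r rewrite double≡m+m (i + r) = arith i r
    where
    arith : ∀ i r → suc (i + r + (i + r)) ≡ i + (i + (2 * r + 1))
    arith = solve-∀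
  regroup : ∀ i r → i + (2 * r + 1) ≡ i + r + r + 1
  regroup = solve-∀

PInv-upper≡fibPoly : ∀ m x → PInv-upper m x ≡ fibPoly x (suc (double m))
PInv-upper≡fibPoly m x = begin
  PInv-upper m x                                 ≡⟨ sumTo-reverse m upper ⟩
  sumTo m (λ i → upper (m ∸ i))                  ≡⟨ sumTo-cong m reindex ⟩
  sumTo m F                                      ≡⟨ sym (+-identityʳ _) ⟩
  sumTo m F + 0                                  ≡⟨ cong (sumTo m F +_) (sym (sumTo-zero m _ tail-vanishes)) ⟩
  sumTo m F + sumTo m (λ j → F (suc m + j))      ≡⟨ sym (sumTo-++ m m F) ⟩
  sumTo (m + suc m) F                            ≡⟨ cong (λ N → sumTo N F) (sym 2m+1≡m+suc-m) ⟩
  fibPoly x (suc (double m))                     ∎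
  where
  upper F : ℕ → ℕ
  upper k = ((m + k + 1) C (2 * k + 1)) * x ^ (m ∸ k)
  F = fibTerm x (suc (double m))
  reindex : ∀ i → i ≤ m → upper (m ∸ i) ≡ F i
  reindex i i≤m with m≤n⇒∃[o]m+o≡n i≤m
  ... | r , refl rewrite m+n∸m≡n i r | m+n∸n≡m i r = cong (_* x ^ i) (sym (C-reindex i r))
  2m+1≡m+suc-m : suc (double m) ≡ m + suc m
  2m+1≡m+suc-m = trans (cong suc (double≡m+m m)) (sym (+-suc m m))
  tail-vanishes : ∀ j → F (suc m + j) ≡ 0
  tail-vanishes j = cong (_* x ^ (suc m + j)) (k>n⇒nCk≡0 (s≤s (≤-trans shrink (m≤m+n m j))))
    where
    shrink : double m ∸ (m + j) ≤ m
    shrink = ≤-trans (∸-monoʳ-≤ (double m) (m≤m+n m j))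
                     (≤-reflexive (trans (cong (_∸ m) (double≡m+m m)) (m+n∸m≡n m m)))

PInv-suc≡fibPoly : ∀ m x →
  PInv (suc m) x ≡ fibPoly x (suc (double (suc m))) + x * fibPoly x (suc (double m))
PInv-suc≡fibPoly m x = begin
  PInv (suc m) x                                 ≡⟨ PInv≡upper+lower (suc m) x ⟩
  PInv-upper (suc m) x + PInv-lower (suc m) x    ≡⟨ cong (PInv-upper (suc m) x +_) (PInv-lower-suc m x) ⟩
  PInv-upper (suc m) x + x * PInv-upper m x      ≡⟨ cong₂ (λ s t → s + x * t) (PInv-upper≡fibPoly (suc m) x)
                                                                           (PInv-upper≡fibPoly m x) ⟩
  fibPoly x (suc (double (suc m))) + x * fibPoly x (suc (double m)) ∎

2m+1≡suc-double : ∀ m → 2 * m + 1 ≡ suc (double m)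
2m+1≡suc-double m = trans (arith m) (cong suc (sym (double≡m+m m)))
  where
  arith : ∀ m → 2 * m + 1 ≡ suc (m + m)
  arith = solve-∀

2m≡double : ∀ m → 2 * m ≡ double m
2m≡double m = trans (arith m) (sym (double≡m+m m))
  where
  arith : ∀ m → 2 * m ≡ m + m
  arith = solve-∀

PInv-telescoping : ∀ m n → PInv m (n * suc n) + n ^ (2 * m + 1) ≡ suc n ^ (2 * m + 1)
PInv-telescoping zero n = base n
  where
  base : ∀ n → 1 + n * 1 ≡ suc n * 1
  base = solve-∀
PInv-telescoping (suc m) n = begin
  PInv (suc m) x + n ^ (2 * suc m + 1)
    ≡⟨ cong₂ (λ P e → P + n ^ e) (PInv-suc≡fibPoly m x) (2m+1≡suc-double (suc m)) ⟩
  F₊ + x * F + n * (n * q)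
    ≡⟨ *-cancelˡ-≡ _ _ w (+-cancelʳ-≡ (x * (n * q) + n * (n * (n * q))) _ _ scaled) ⟩
  u * (u * p)
    ≡⟨ cong (u ^_) (sym (2m+1≡suc-double (suc m))) ⟩
  u ^ (2 * suc m + 1) ∎
  where
  u = suc n
  x = n * suc n
  w = suc (n + n)
  p = u ^ suc (double m)
  q = n ^ suc (double m)
  F₊ = fibPoly x (suc (double (suc m)))
  F = fibPoly x (suc (double m))
  regroup : ∀ n w a b q → w * ((a + (n * suc n) * b) + n * (n * q)) + ((n * suc n) * (n * q) + n * (n * (n * q)))
                         ≡ (w * a + n * (n * (n * q))) + (n * suc n) * (w * b + n * q) + w * (n * (n * q))
  regroup = solve-∀
  expand : ∀ n p q → suc n * (suc n * (suc n * p)) + (n * suc n) * (suc n * p) + suc (n + n) * (n * (n * q))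
                     ≡ suc (n + n) * (suc n * (suc n * p)) + ((n * suc n) * (n * q) + n * (n * (n * q)))
  expand = solve-∀

  scaled : w * (F₊ + x * F + n * (n * q)) + (x * (n * q) + n * (n * (n * q)))
         ≡ w * (u * (u * p)) + (x * (n * q) + n * (n * (n * q)))
  scaled = begin
    w * (F₊ + x * F + n * (n * q)) + (x * (n * q) + n * (n * (n * q)))
      ≡⟨ regroup n w F₊ F q ⟩
    (w * F₊ + n * (n * (n * q))) + x * (w * F + n * q) + w * (n * (n * q))
      ≡⟨ cong₂ (λ s t → s + x * t + w * (n * (n * q)))
               (proj₂ (fibPoly-closedForm n (suc m))) (proj₂ (fibPoly-closedForm n m)) ⟩
    u * (u * (u * p)) + x * (u * p) + w * (n * (n * q))
      ≡⟨ expand n p q ⟩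
    w * (u * (u * p)) + (x * (n * q) + n * (n * (n * q))) ∎

QInv-telescoping : ∀ m n → 1 ≤ m → (2 * n + 1) * QInv m (n * suc n) + n ^ (2 * m) ≡ suc n ^ (2 * m)
QInv-telescoping (suc m) n _ = begin
  (2 * n + 1) * QInv (suc m) x + n ^ (2 * suc m)
    ≡⟨ cong₂ (λ c Q → c * Q + n ^ (2 * suc m)) 2n+1≡w Q≡F ⟩
  w * F + n ^ (2 * suc m)
    ≡⟨ cong (λ e → w * F + n ^ e) (2m≡double (suc m)) ⟩
  w * F + n ^ double (suc m)
    ≡⟨ proj₂ (fibPoly-closedForm n m) ⟩
  suc n ^ double (suc m)
    ≡⟨ cong (suc n ^_) (sym (2m≡double (suc m))) ⟩
  suc n ^ (2 * suc m) ∎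
  where
  x = n * suc n
  w = suc (n + n)
  F = fibPoly x (suc (double m))
  2n+1≡w : 2 * n + 1 ≡ w
  2n+1≡w = trans (2m+1≡suc-double n) (cong suc (double≡m+m n))
  Q≡F : QInv (suc m) x ≡ F
  Q≡F = trans (QInv-suc≡PInv-upper m x) (PInv-upper≡fibPoly m x)

-- k ≥ 1 because the empty sum is 0 while 0 ^ 0 = 1.
sumRange-telescope : ∀ (f : ℕ → ℕ) k → 1 ≤ k → (∀ n → f n + n ^ k ≡ suc n ^ k) →
                     ∀ a → sumRange 0 a f ≡ a ^ k
sumRange-telescope f (suc k) _   step zero    = refl
sumRange-telescope f (suc k) 1≤k step (suc a) =
  trans (cong (_+ f a) (sumRange-telescope f (suc k) 1≤k step a)) (trans (+-comm _ (f a)) (step a))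

sum-of-powers⇔sumRange : ∀ (f : ℕ → ℕ) k → 1 ≤ k → (∀ n → f n + n ^ k ≡ suc n ^ k) →
  ∀ a b c → b ≤ c → (a ^ k + b ^ k ≡ c ^ k) ⇔ (sumRange 0 a f ≡ sumRange b c f)
sum-of-powers⇔sumRange f k 1≤k step a b c b≤c = mk⇔ to from
  where
  powers = sumRange-telescope f k 1≤k step
  c^k≡b^k+sum : c ^ k ≡ b ^ k + sumRange b c f
  c^k≡b^k+sum = begin
    c ^ k                             ≡⟨ sym (powers c) ⟩
    sumRange 0 c f                    ≡⟨ sumRange-split b c f b≤c ⟩
    sumRange 0 b f + sumRange b c f   ≡⟨ cong (_+ sumRange b c f) (powers b) ⟩
    b ^ k + sumRange b c f            ∎
  to : a ^ k + b ^ k ≡ c ^ k → sumRange 0 a f ≡ sumRange b c f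
  to eq = trans (powers a) (+-cancelˡ-≡ (b ^ k) _ _ (trans (+-comm (b ^ k) _) (trans eq c^k≡b^k+sum)))
  from : sumRange 0 a f ≡ sumRange b c f → a ^ k + b ^ k ≡ c ^ k
  from eq = trans (cong (_+ b ^ k) (trans (sym (powers a)) eq)) (trans (+-comm _ (b ^ k)) (sym c^k≡b^k+sum))

¬∃-cong : ∀ {A B : ℕ → ℕ → ℕ → Set} →
  (∀ a b c → 1 ≤ a → a ≤ b → b ≤ c → A a b c ⇔ B a b c) →
  (¬ (Σ[ a ∈ ℕ ] Σ[ b ∈ ℕ ] Σ[ c ∈ ℕ ] (1 ≤ a × a ≤ b × b ≤ c × A a b c))) ⇔
  (¬ (Σ[ a ∈ ℕ ] Σ[ b ∈ ℕ ] Σ[ c ∈ ℕ ] (1 ≤ a × a ≤ b × b ≤ c × B a b c)))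
¬∃-cong A⇔B = mk⇔
  (λ ¬A (a , b , c , h₁ , h₂ , h₃ , B-abc) → ¬A (a , b , c , h₁ , h₂ , h₃ , Equivalence.from (A⇔B a b c h₁ h₂ h₃) B-abc))
  (λ ¬B (a , b , c , h₁ , h₂ , h₃ , A-abc) → ¬B (a , b , c , h₁ , h₂ , h₃ , Equivalence.to (A⇔B a b c h₁ h₂ h₃) A-abc))

odd-power-equation⇔PInv-sums : (a b c m : ℕ) → 1 ≤ a → a ≤ b → b ≤ c →
  (a ^ (2 * m + 1) + b ^ (2 * m + 1) ≡ c ^ (2 * m + 1)) ⇔
  (sumRange 0 a (λ j → PInv m (j * suc j)) ≡ sumRange b c (λ j → PInv m (j * suc j)))
odd-power-equation⇔PInv-sums a b c m _ _ b≤c =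
  sum-of-powers⇔sumRange _ (2 * m + 1) 1≤2m+1 (PInv-telescoping m) a b c b≤c
  where
  1≤2m+1 : 1 ≤ 2 * m + 1
  1≤2m+1 = m≤n+m 1 (2 * m)

even-power-equation⇔QInv-sums : (a b c m : ℕ) → 1 ≤ a → a ≤ b → b ≤ c → 1 ≤ m →
  (a ^ (2 * m) + b ^ (2 * m) ≡ c ^ (2 * m)) ⇔
  (sumRange 0 a (λ j → (2 * j + 1) * QInv m (j * suc j)) ≡ sumRange b c (λ j → (2 * j + 1) * QInv m (j * suc j)))
even-power-equation⇔QInv-sums a b c m _ _ b≤c 1≤m =
  sum-of-powers⇔sumRange _ (2 * m) (≤-trans 1≤m (m≤m+n m _)) (λ n → QInv-telescoping m n 1≤m) a b c b≤c

corollary2 :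
      ((a b c m : ℕ) → 1 ≤ a → a ≤ b → b ≤ c →
        ((a ^ (2 * m + 1) + b ^ (2 * m + 1) ≡ c ^ (2 * m + 1)) ⇔
         (sumRange 0 a (λ j → PInv m (j * suc j)) ≡ sumRange b c (λ j → PInv m (j * suc j)))))
    × ((m : ℕ) → 1 ≤ m →
        (¬ (Σ[ a ∈ ℕ ] Σ[ b ∈ ℕ ] Σ[ c ∈ ℕ ] (1 ≤ a × a ≤ b × b ≤ c × a ^ (2 * m + 1) + b ^ (2 * m + 1) ≡ c ^ (2 * m + 1)))) ⇔
        (¬ (Σ[ a ∈ ℕ ] Σ[ b ∈ ℕ ] Σ[ c ∈ ℕ ] (1 ≤ a × a ≤ b × b ≤ c × sumRange 0 a (λ j → PInv m (j * suc j)) ≡ sumRange b c (λ j → PInv m (j * suc j))))))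
    × ((a b c m : ℕ) → 1 ≤ a → a ≤ b → b ≤ c → 1 ≤ m →
        ((a ^ (2 * m) + b ^ (2 * m) ≡ c ^ (2 * m)) ⇔
         (sumRange 0 a (λ j → (2 * j + 1) * QInv m (j * suc j)) ≡ sumRange b c (λ j → (2 * j + 1) * QInv m (j * suc j)))))
    × ((m : ℕ) → 2 ≤ m →
        (¬ (Σ[ a ∈ ℕ ] Σ[ b ∈ ℕ ] Σ[ c ∈ ℕ ] (1 ≤ a × a ≤ b × b ≤ c × a ^ (2 * m) + b ^ (2 * m) ≡ c ^ (2 * m)))) ⇔
        (¬ (Σ[ a ∈ ℕ ] Σ[ b ∈ ℕ ] Σ[ c ∈ ℕ ] (1 ≤ a × a ≤ b × b ≤ c × sumRange 0 a (λ j → (2 * j + 1) * QInv m (j * suc j)) ≡ sumRange b c (λ j → (2 * j + 1) * QInv m (j * suc j))))))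
corollary2 =
    odd-power-equation⇔PInv-sums
  , (λ m _ → ¬∃-cong (λ a b c → odd-power-equation⇔PInv-sums a b c m))
  , even-power-equation⇔QInv-sums
  , (λ m 2≤m → ¬∃-cong (λ a b c 1≤a a≤b b≤c →
                  even-power-equation⇔QInv-sums a b c m 1≤a a≤b b≤c (≤-trans (s≤s z≤n) 2≤m)))
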